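{- Let $(G,T)$ be a terminal network with $\mathrm{cap}_G(T)=k$. Let $\mathcal{T}$ be a partition of $T$ and $X$ a minimum multiway cut for $\mathcal{T}$ in $G$. Let $V=V_1\cup\dots\cup V_s$ be the partition of $V(G)$ into the vertex sets of the connected components of $G-X$, ordered so that $\mathrm{cap}_T(V_1)\ge\dots\ge\mathrm{cap}_T(V_s)$. Then for every $i\in[s]$, $\mathrm{cap}_T(V_i)\le 3k/i$.
   Context: Graphs are undirected. $\mathrm{cap}_G(S)=\sum_{v\in S}d_G(v)$; $\delta_G(S)$ is the number of edges with exactly one endpoint in $S$; $\mathrm{cap}_T(S)=\mathrm{cap}_G(T\cap S)+\delta_G(S)$. A multiway cut for a partition $\mathcal{T}$ of $T$ is a set $X\subseteq E(G)$ such that every connected component of $G-X$ contains terminals from at most one part of $\mathcal{T}$; minimum means minimum cardinality. -}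

module Defs where

open import Data.Nat using (ℕ; zero; suc; _+_; _*_; _≤_)
open import Data.Fin using (Fin; zero; suc; _≟_)
open import Data.Bool using (Bool; true; false; _∧_; _xor_; if_then_else_)
open import Data.Product using (_×_; _,_; proj₁; proj₂; ∃; ∃-syntax)
open import Relation.Nullary using (¬_)
open import Relation.Nullary.Decidable using (⌊_⌋)
open import Data.Bool using (_∨_)
open import Relation.Binary.PropositionalEquality using (_≡_)

Σfin : (n : ℕ) → (Fin n → ℕ) → ℕ
Σfin zero    f = 0
Σfin (suc n) f = f zero + Σfin n (λ i → f (suc i))

count : (n : ℕ) → (Fin n → Bool) → ℕ
count n P = Σfin n (λ i → if P i then 1 else 0)

VSet : ℕ → Set
VSet n = Fin n → Bool

_∩_ : ∀ {n} → VSet n → VSet n → VSet n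
(A ∩ B) v = A v ∧ B v

-- An undirected (loopless) multigraph with vertices Fin n and edges Fin m;
-- each edge has two distinct endpoints.
record Graph (n m : ℕ) : Set where
  field
    ends     : Fin m → Fin n × Fin n
    loopless : ∀ e → ¬ (proj₁ (ends e) ≡ proj₂ (ends e))
open Graph public

module _ {n m : ℕ} (G : Graph n m) where

  incident : Fin n → Fin m → Bool
  incident v e = ⌊ v ≟ proj₁ (ends G e) ⌋ ∨ ⌊ v ≟ proj₂ (ends G e) ⌋

  deg : Fin n → ℕ
  deg v = count m (incident v)

  capG : VSet n → ℕ
  capG S = Σfin n (λ v → if S v then deg v else 0)

  δ : VSet n → ℕ
  δ S = count m (λ e → S (proj₁ (ends G e)) xor S (proj₂ (ends G e)))

  capT : VSet n → VSet n → ℕ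
  capT T S = capG (T ∩ S) + δ S

  -- Reachability in G - X (X an edge set, X e ≡ true means e ∈ X).
  data Reach (X : Fin m → Bool) : Fin n → Fin n → Set where
    here  : ∀ {u} → Reach X u u
    fwd   : ∀ {u w} (e : Fin m) → X e ≡ false → proj₁ (ends G e) ≡ u →
            Reach X (proj₂ (ends G e)) w → Reach X u w
    bwd   : ∀ {u w} (e : Fin m) → X e ≡ false → proj₂ (ends G e) ≡ u →
            Reach X (proj₁ (ends G e)) w → Reach X u w

  -- X is a multiway cut for the partition of T given by the labelling c
  -- (terminals t, t' lie in the same part iff c t ≡ c t'): every connected
  -- component of G - X contains terminals from at most one part.
  IsMultiwayCut : VSet n → (Fin n → ℕ) → (Fin m → Bool) → Set
  IsMultiwayCut T c X =
    ∀ t t' → T t ≡ true → T t' ≡ true → Reach X t t' → c t ≡ c t'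

  IsMinMultiwayCut : VSet n → (Fin n → ℕ) → (Fin m → Bool) → Set
  IsMinMultiwayCut T c X =
    IsMultiwayCut T c X ×
    (∀ Y → IsMultiwayCut T c Y → count m X ≤ count m Y)

  -- V : Fin s → VSet n lists the vertex sets of the connected components
  -- of G - X, each exactly once.
  IsComponentPartition : (X : Fin m → Bool) (s : ℕ) → (Fin s → VSet n) → Set
  IsComponentPartition X s V =
    (∀ j → ∃[ r ] (∀ w → V j w ≡ true → Reach X r w)
                × (∀ w → Reach X r w → V j w ≡ true)) ×
    (∀ v → ∃[ j ] V j v ≡ true) ×
    (∀ j j' v → V j v ≡ true → V j' v ≡ true → j ≡ j')

-- Summing cap_T over all components counts cap_G(T) once (the components
-- are disjoint) and every cut edge at most twice (an uncut edge never leaves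
-- a component), so Σ_j cap_T(V_j) ≤ k + 2|X|.  Deleting all edges at the
-- terminals is a multiway cut with at most k edges, so minimality gives
-- |X| ≤ k and the sum is at most 3k.  As the V_j are sorted by decreasing
-- cap_T, each of V_1, …, V_i has cap_T at least cap_T(V_i), so
-- i · cap_T(V_i) ≤ 3k.
module Submission where

open import Defs
open import Data.Nat using (ℕ; suc; _*_; _≤_)
open import Data.Fin using (Fin; toℕ; _≤_)
open import Data.Bool using (Bool)
open import Data.Nat as ℕ using (zero; _+_; z≤n; s≤s)
open import Data.Nat.Properties
  using (+-0-commutativeMonoid; +-mono-≤; +-monoʳ-≤; +-identityʳ; m≤m+n; m≤n+m; ≤-trans; ≤-reflexive; module ≤-Reasoning)
open import Algebra.Properties.CommutativeMonoid.Sum +-0-commutativeMonoid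
  using (sum; sum-cong-≗; ∑-distrib-+; ∑-comm)
import Data.Fin as Fin
open import Data.Fin.Properties using (suc-injective)
open import Data.Bool using (true; false; if_then_else_; _∧_; _∨_; _xor_)
open import Data.Bool.Properties using (∨-zeroʳ)
open import Data.Product using (_×_; _,_; proj₁; proj₂; ∃-syntax)
open import Function using (_∘_)
open import Relation.Binary.PropositionalEquality
open import Relation.Nullary.Decidable using (⌊_⌋; isYes≗does; dec-true)

Σfin-sum : ∀ n (f : Fin n → ℕ) → Σfin n f ≡ sum f
Σfin-sum zero    f = refl
Σfin-sum (suc n) f = cong (f Fin.zero +_) (Σfin-sum n (f ∘ Fin.suc))

Σfin-cong : ∀ n {f g : Fin n → ℕ} → (∀ i → f i ≡ g i) → Σfin n f ≡ Σfin n g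
Σfin-cong zero    f≗g = refl
Σfin-cong (suc n) f≗g = cong₂ _+_ (f≗g Fin.zero) (Σfin-cong n (f≗g ∘ Fin.suc))

Σfin-zero : ∀ n {f : Fin n → ℕ} → (∀ i → f i ≡ 0) → Σfin n f ≡ 0
Σfin-zero zero    f≗0 = refl
Σfin-zero (suc n) f≗0 rewrite f≗0 Fin.zero = Σfin-zero n (f≗0 ∘ Fin.suc)

Σfin-mono-≤ : ∀ n {f g : Fin n → ℕ} → (∀ i → f i ℕ.≤ g i) → Σfin n f ℕ.≤ Σfin n g
Σfin-mono-≤ zero    f≤g = z≤n
Σfin-mono-≤ (suc n) f≤g = +-mono-≤ (f≤g Fin.zero) (Σfin-mono-≤ n (f≤g ∘ Fin.suc))

Σfin-distrib-+ : ∀ n (f g : Fin n → ℕ) →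
                 Σfin n (λ i → f i + g i) ≡ Σfin n f + Σfin n g
Σfin-distrib-+ n f g = begin
  Σfin n (λ i → f i + g i)  ≡⟨ Σfin-sum n _ ⟩
  sum (λ i → f i + g i)     ≡⟨ ∑-distrib-+ f g ⟩
  sum f + sum g             ≡⟨ sym (cong₂ _+_ (Σfin-sum n f) (Σfin-sum n g)) ⟩
  Σfin n f + Σfin n g       ∎
  where open ≡-Reasoning

Σfin-comm : ∀ n m (h : Fin n → Fin m → ℕ) →
            Σfin n (λ v → Σfin m (h v)) ≡ Σfin m (λ e → Σfin n (λ v → h v e))
Σfin-comm n m h = begin
  Σfin n (λ v → Σfin m (h v))          ≡⟨ Σfin-sum n _ ⟩
  sum (λ v → Σfin m (h v))             ≡⟨ sum-cong-≗ (λ v → Σfin-sum m (h v)) ⟩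
  sum (λ v → sum (h v))                ≡⟨ ∑-comm h ⟩
  sum (λ e → sum (λ v → h v e))        ≡⟨ sym (sum-cong-≗ (λ e → Σfin-sum n (λ v → h v e))) ⟩
  sum (λ e → Σfin n (λ v → h v e))     ≡⟨ sym (Σfin-sum m _) ⟩
  Σfin m (λ e → Σfin n (λ v → h v e))  ∎
  where open ≡-Reasoning

f≤Σfin : ∀ n (f : Fin n → ℕ) i → f i ℕ.≤ Σfin n f
f≤Σfin (suc n) f Fin.zero    = m≤m+n _ _
f≤Σfin (suc n) f (Fin.suc i) = ≤-trans (f≤Σfin n (f ∘ Fin.suc) i) (m≤n+m _ _)

antitone⇒[1+i]*f[i]≤Σfin : ∀ s (f : Fin s → ℕ) →
  (∀ (j j' : Fin s) → j Fin.≤ j' → f j' ℕ.≤ f j) →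
  ∀ i → suc (toℕ i) * f i ℕ.≤ Σfin s f
antitone⇒[1+i]*f[i]≤Σfin (suc s) f antitone Fin.zero    = +-monoʳ-≤ (f Fin.zero) z≤n
antitone⇒[1+i]*f[i]≤Σfin (suc s) f antitone (Fin.suc i) =
  +-mono-≤ (antitone Fin.zero (Fin.suc i) z≤n)
           (antitone⇒[1+i]*f[i]≤Σfin s (f ∘ Fin.suc)
              (λ j j' j≤j' → antitone (Fin.suc j) (Fin.suc j') (s≤s j≤j')) i)

AtMostOne : ∀ {s} → (Fin s → Bool) → Set
AtMostOne P = ∀ j j' → P j ≡ true → P j' ≡ true → j ≡ j'

Σfin-if-atMostOne : ∀ s (P : Fin s → Bool) d → AtMostOne P →
                    Σfin s (λ j → if P j then d else 0) ℕ.≤ d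
Σfin-if-atMostOne zero    P d unique = z≤n
Σfin-if-atMostOne (suc s) P d unique with P Fin.zero in P0
... | true  = ≤-reflexive (trans (cong (d +_) (Σfin-zero s rest-zero)) (+-identityʳ d))
  where
  rest-zero : ∀ i → (if P (Fin.suc i) then d else 0) ≡ 0
  rest-zero i with P (Fin.suc i) in Pi
  ... | true  with () ← unique Fin.zero (Fin.suc i) P0 Pi
  ... | false = refl
... | false = Σfin-if-atMostOne s (P ∘ Fin.suc) d
                (λ j j' Pj Pj' → suc-injective (unique _ _ Pj Pj'))

if-xor≤if+if : ∀ a b → (if a xor b then 1 else 0) ℕ.≤ (if a then 1 else 0) + (if b then 1 else 0)
if-xor≤if+if true  true  = z≤n
if-xor≤if+if true  false = s≤s z≤n
if-xor≤if+if false true  = s≤s z≤n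
if-xor≤if+if false false = z≤n

if-xor-self : ∀ b → (if b xor b then 1 else 0) ≡ 0
if-xor-self true  = refl
if-xor-self false = refl

if-count : ∀ b m (P : Fin m → Bool) →
           (if b then count m P else 0) ≡ Σfin m (λ e → if b ∧ P e then 1 else 0)
if-count true  m P = refl
if-count false m P = sym (Σfin-zero m (λ _ → refl))

module _ {n m : ℕ} (G : Graph n m) where

  private
    src tgt : Fin m → Fin n
    src e = proj₁ (ends G e)
    tgt e = proj₂ (ends G e)

  Reach-trans : ∀ {X a b d} → Reach G X a b → Reach G X b d → Reach G X a d
  Reach-trans here                q = q
  Reach-trans (fwd e uncut at r) q = fwd e uncut at (Reach-trans r q)
  Reach-trans (bwd e uncut at r) q = bwd e uncut at (Reach-trans r q)

  ReachClosed : (Fin m → Bool) → VSet n → Set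
  ReachClosed X S = ∀ {a b} → S a ≡ true → Reach G X a b → S b ≡ true

  component⇒ReachClosed : ∀ {X S} →
    ∃[ r ] (∀ w → S w ≡ true → Reach G X r w) × (∀ w → Reach G X r w → S w ≡ true) →
    ReachClosed X S
  component⇒ReachClosed (r , r⇝ , ⇝S) Sa a⇝b = ⇝S _ (Reach-trans (r⇝ _ Sa) a⇝b)

  ReachClosed⇒uncut-edge-internal : ∀ {X S} → ReachClosed X S →
    ∀ e → X e ≡ false → S (src e) ≡ S (tgt e)
  ReachClosed⇒uncut-edge-internal {S = S} closed e uncut
    with S (src e) in Ssrc | S (tgt e) in Stgt
  ... | true  | true  = refl
  ... | false | false = refl
  ... | true  | false with () ← trans (sym Stgt) (closed Ssrc (fwd e uncut refl here))
  ... | false | true  with () ← trans (sym Ssrc) (closed Stgt (bwd e uncut refl here))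

  Σδ≤2*cut : ∀ {X s} (V : Fin s → VSet n) →
    (∀ j e → X e ≡ false → V j (src e) ≡ V j (tgt e)) →
    (∀ v → AtMostOne (λ j → V j v)) →
    Σfin s (λ j → δ G (V j)) ℕ.≤ count m X + count m X
  Σδ≤2*cut {X} {s} V internal disjoint = begin
    Σfin s (λ j → δ G (V j))            ≡⟨ Σfin-comm s m _ ⟩
    Σfin m crossings                    ≤⟨ Σfin-mono-≤ m crossings≤2[X] ⟩
    Σfin m (λ e → [X] e + [X] e)        ≡⟨ Σfin-distrib-+ m [X] [X] ⟩
    count m X + count m X               ∎
    where
    open ≤-Reasoning
    [X] : Fin m → ℕ
    [X] e = if X e then 1 else 0
    crossings : Fin m → ℕ
    crossings e = Σfin s (λ j → if V j (src e) xor V j (tgt e) then 1 else 0)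
    crossings≤2[X] : ∀ e → crossings e ℕ.≤ [X] e + [X] e
    crossings≤2[X] e with X e in Xe
    ... | false = ≤-reflexive (Σfin-zero s λ j →
            trans (cong (λ b → if b xor V j (tgt e) then 1 else 0) (internal j e Xe))
                  (if-xor-self (V j (tgt e))))
    ... | true  = begin
      crossings e                            ≤⟨ Σfin-mono-≤ s (λ j → if-xor≤if+if (V j (src e)) (V j (tgt e))) ⟩
      Σfin s (λ j → ∈src j + ∈tgt j)         ≡⟨ Σfin-distrib-+ s ∈src ∈tgt ⟩
      Σfin s ∈src + Σfin s ∈tgt              ≤⟨ +-mono-≤ (Σfin-if-atMostOne s _ 1 (disjoint (src e)))
                                                         (Σfin-if-atMostOne s _ 1 (disjoint (tgt e))) ⟩
      1 + 1                                  ∎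
      where
      ∈src ∈tgt : Fin s → ℕ
      ∈src j = if V j (src e) then 1 else 0
      ∈tgt j = if V j (tgt e) then 1 else 0

  ΣcapG∩≤capG : ∀ {s} (T : VSet n) (V : Fin s → VSet n) →
    (∀ v → AtMostOne (λ j → V j v)) →
    Σfin s (λ j → capG G (T ∩ V j)) ℕ.≤ capG G T
  ΣcapG∩≤capG {s} T V disjoint =
    ≤-trans (≤-reflexive (Σfin-comm s n _)) (Σfin-mono-≤ n per-vertex)
    where
    per-vertex : ∀ v → Σfin s (λ j → if T v ∧ V j v then deg G v else 0)
                       ℕ.≤ (if T v then deg G v else 0)
    per-vertex v with T v
    ... | true  = Σfin-if-atMostOne s (λ j → V j v) (deg G v) (disjoint v)
    ... | false = ≤-reflexive (Σfin-zero s (λ _ → refl))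

  terminalEdges : VSet n → Fin m → Bool
  terminalEdges T e = T (src e) ∨ T (tgt e)

  terminalEdges-isMultiwayCut : ∀ T c → IsMultiwayCut G T c (terminalEdges T)
  terminalEdges-isMultiwayCut T c t t' Tt Tt' here = refl
  terminalEdges-isMultiwayCut T c t t' Tt Tt' (fwd e uncut refl _)
    with () ← trans (sym uncut) (cong (_∨ T (tgt e)) Tt)
  terminalEdges-isMultiwayCut T c t t' Tt Tt' (bwd e uncut refl _)
    with () ← trans (sym uncut) (trans (cong (T (src e) ∨_) Tt) (∨-zeroʳ _))

  private
    ⌊x≟x⌋ : ∀ (x : Fin n) → ⌊ x Fin.≟ x ⌋ ≡ true
    ⌊x≟x⌋ x = trans (isYes≗does (x Fin.≟ x)) (dec-true (x Fin.≟ x) refl)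

  incident-src : ∀ e → incident G (src e) e ≡ true
  incident-src e = cong (_∨ ⌊ src e Fin.≟ tgt e ⌋) (⌊x≟x⌋ (src e))

  incident-tgt : ∀ e → incident G (tgt e) e ≡ true
  incident-tgt e = trans (cong (⌊ tgt e Fin.≟ src e ⌋ ∨_) (⌊x≟x⌋ (tgt e))) (∨-zeroʳ _)

  count-terminalEdges≤capG : ∀ T → count m (terminalEdges T) ℕ.≤ capG G T
  count-terminalEdges≤capG T = begin
    count m (terminalEdges T)                  ≤⟨ Σfin-mono-≤ m [terminalEdge]≤incidences ⟩
    Σfin m (λ e → Σfin n (λ v → incidence v e)) ≡⟨ Σfin-comm m n _ ⟩
    Σfin n (λ v → Σfin m (incidence v))         ≡⟨ Σfin-cong n (λ v → if-count (T v) m (incident G v)) ⟨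
    capG G T                                    ∎
    where
    open ≤-Reasoning
    incidence : Fin n → Fin m → ℕ
    incidence v e = if T v ∧ incident G v e then 1 else 0
    at-terminal : ∀ {e} v → T v ≡ true → incident G v e ≡ true →
                  1 ℕ.≤ Σfin n (λ v → incidence v e)
    at-terminal {e} v Tv inc =
      ≤-trans (≤-reflexive (sym (cong₂ (λ a b → if a ∧ b then 1 else 0) Tv inc)))
              (f≤Σfin n (λ v → incidence v e) v)
    [terminalEdge]≤incidences : ∀ e → (if terminalEdges T e then 1 else 0)
                                      ℕ.≤ Σfin n (λ v → incidence v e)
    [terminalEdge]≤incidences e with T (src e) in Tsrc
    ... | true  = at-terminal (src e) Tsrc (incident-src e)
    ... | false with T (tgt e) in Ttgt
    ...   | true  = at-terminal (tgt e) Ttgt (incident-tgt e)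
    ...   | false = z≤n

proposition11 : ∀ {n m} (G : Graph n m) (T : VSet n) (c : Fin n → ℕ)
    (X : Fin m → Bool) → IsMinMultiwayCut G T c X →
    (s : ℕ) (V : Fin s → VSet n) → IsComponentPartition G X s V →
    (∀ (j j' : Fin s) → j Data.Fin.≤ j' → capT G T (V j') Data.Nat.≤ capT G T (V j)) →
    ∀ (i : Fin s) → suc (toℕ i) * capT G T (V i) Data.Nat.≤ 3 * capG G T
proposition11 {m = m} G T c X (_ , minimal) s V (components , _ , unique) antitone i = begin
  suc (toℕ i) * capT G T (V i)                            ≤⟨ antitone⇒[1+i]*f[i]≤Σfin s _ antitone i ⟩
  Σfin s (λ j → capT G T (V j))                           ≡⟨ Σfin-distrib-+ s _ _ ⟩
  Σfin s (λ j → capG G (T ∩ V j)) + Σfin s (δ G ∘ V)      ≤⟨ +-mono-≤ (ΣcapG∩≤capG G T V disjoint)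
                                                                     (Σδ≤2*cut G V internal disjoint) ⟩
  k + (count m X + count m X)                             ≤⟨ +-monoʳ-≤ k (+-mono-≤ |X|≤k (≤-trans |X|≤k (m≤m+n k 0))) ⟩
  3 * k                                                   ∎
  where
  open ≤-Reasoning
  k = capG G T
  disjoint : ∀ v → AtMostOne (λ j → V j v)
  disjoint v j j' = unique j j' v
  internal : ∀ j e → X e ≡ false → V j (proj₁ (ends G e)) ≡ V j (proj₂ (ends G e))
  internal j = ReachClosed⇒uncut-edge-internal G (component⇒ReachClosed G (components j))
  |X|≤k : count m X ℕ.≤ k
  |X|≤k = ≤-trans (minimal _ (terminalEdges-isMultiwayCut G T c)) (count-terminalEdges≤capG G T)
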